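{- Let $r$ be a positive integer. Then $(1,r,h_2)$ is a pure $O$-sequence if and only if $\lceil r/2\rceil\le h_2\le\binom{r+1}{2}$. Consequently the set of pure $O$-sequences of socle degree $2$ has the interval property: if $(1,h_1,h_2)$ and $(1,h_1',h_2')$ are pure $O$-sequences agreeing in all but one entry, then every sequence obtained by giving that entry any intermediate integer value is also a pure $O$-sequence.
   Context: A monomial order ideal is a finite nonempty set of monomials closed under taking divisors; it is pure if all its maximal monomials under divisibility have the same degree $e$ (the socle degree). A pure $O$-sequence is the vector $(h_0,\dots,h_e)$ counting the monomials of each degree in a pure monomial order ideal of socle degree $e$. -}

module Defs where

open import Data.Nat using (ℕ; _≤_; _≟_)
open import Data.Fin using (Fin; toℕ)
open import Data.Vec using (Vec; lookup; sum; _[_]≔_)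
open import Data.List using (List; []; length; filter)
open import Data.List.Membership.Propositional using (_∈_)
open import Data.List.Relation.Unary.Unique.Propositional using (Unique)
open import Data.Product using (Σ; _×_)
open import Data.Sum using (_⊎_)
open import Relation.Binary.PropositionalEquality using (_≡_; _≢_)

Monomial : ℕ → Set
Monomial n = Vec ℕ n

deg : ∀ {n} → Monomial n → ℕ
deg m = sum m

_∣ᵐ_ : ∀ {n} → Monomial n → Monomial n → Set
_∣ᵐ_ {n} m' m = (k : Fin n) → lookup m' k ≤ lookup m k

record IsOrderIdeal {n : ℕ} (L : List (Monomial n)) : Set where
  field
    unique   : Unique L
    nonempty : L ≢ []
    closed   : ∀ {m m'} → m ∈ L → m' ∣ᵐ m → m' ∈ L

IsMaximal : ∀ {n} → List (Monomial n) → Monomial n → Set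
IsMaximal L m = m ∈ L × (∀ {m'} → m' ∈ L → m ∣ᵐ m' → m' ≡ m)

IsPure : ∀ {n} → ℕ → List (Monomial n) → Set
IsPure e L = ∀ {m} → IsMaximal L m → deg m ≡ e

countDeg : ∀ {n} → ℕ → List (Monomial n) → ℕ
countDeg d L = length (filter (λ m → deg m ≟ d) L)

IsPureOSeq : (e : ℕ) → Vec ℕ (Data.Nat.suc e) → Set
IsPureOSeq e h =
  Σ ℕ λ n → Σ (List (Monomial n)) λ L →
    IsOrderIdeal L × IsPure e L × ((i : Fin (Data.Nat.suc e)) → lookup h i ≡ countDeg (toℕ i) L)

Between : ℕ → ℕ → ℕ → Set
Between a b v = (a ≤ v × v ≤ b) ⊎ (b ≤ v × v ≤ a)

-- Necessity.  Let L be a pure order ideal of socle degree 2 with h-vector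
-- (h₀, h₁, h₂).  The only degree-0 monomial is 1, so h₀ = 1.  Every member
-- divides a maximal one, of degree 2; so h₂ ≥ 1, and each variable of L is
-- one of the two degree-1 factors of some degree-2 member, whence h₁ ≤ 2h₂.
-- Every degree-2 member is the product of two variables of L (closure under
-- divisors), whence h₂ ≤ (h₁+1 choose 2).
--
-- Sufficiency.  By induction on r we build a cover: h distinct degree-2
-- monomials in r variables such that every variable divides one of them.
-- Together with 1 and the variables a cover forms a pure order ideal with
-- h-vector (1, r, h).
--
-- The interval property then holds because, in each coordinate, the
-- admissible values form the intersection of an up-closed and a down-closed
-- subset of ℕ.

module Submission where

open import Defs
open import Data.Nat using (ℕ; zero; suc; _≤_; _<_; _+_; _∸_; _⊓_; ⌈_/2⌉; z≤n; s≤s; _≤?_; _≟_)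
open import Data.Nat.Properties
  using ( +-cancelʳ-≤; +-cancelˡ-≤; +-comm; +-identityʳ; +-mono-≤; +-monoʳ-≤; +-suc
        ; 0≢1+n; 1+n≢n; 1+n≰n; suc-injective; m+[n∸m]≡n; m+n∸n≡m; m≤m+n; m≤n+m
        ; m≤n⇒m<n∨m≡n; m≤n⇒m⊓n≡m; n≤0⇒n≡0; n≤1+n; ∸-monoˡ-≤
        ; ≤-antisym; ≤-pred; ≤-refl; ≤-reflexive; ≤-trans; ≰⇒>
        ; n≡⌈n+n/2⌉; ⌈n/2⌉-mono; ⌈n/2⌉≤n; ⌊n/2⌋≤n; module ≤-Reasoning )
open import Data.Nat.Combinatorics using (_C_; nC1≡n; nCk+nC[k+1]≡[n+1]C[k+1])
open import Data.Fin using (Fin) renaming (zero to fz; suc to fs)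
open import Data.Vec using (Vec; _∷_; []; lookup; zipWith; replicate; _[_]≔_)
import Data.Vec.Relation.Binary.Pointwise.Inductive as Pointwise
open Pointwise using (Pointwise; _∷_; [])
open import Data.List using (List; []; _∷_; length; filter; map; take; _++_)
open import Data.List.Properties using (length-map; length-++; length-take; length-removeAt′; filter-all; filter-none; filter-++)
open import Data.List.Membership.Propositional using (_∈_; find)
open import Data.List.Membership.Propositional.Properties using (∈-map⁺; ∈-map⁻; ∈-++⁺ˡ; ∈-++⁺ʳ; ∈-++⁻; ∈-filter⁺; ∈-filter⁻)
open import Data.List.Relation.Binary.Subset.Propositional using (_⊆_)
open import Data.List.Relation.Unary.Any as Any using (Any; here; there; _─_; index)
import Data.List.Relation.Unary.Any.Properties as Any
open import Data.List.Relation.Unary.All as All using (All; []; _∷_)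
import Data.List.Relation.Unary.All.Properties as All
open import Data.List.Relation.Unary.Unique.Propositional using (Unique; []; _∷_)
import Data.List.Relation.Unary.Unique.Propositional.Properties as Unique
open import Data.List.Extrema.Nat using (argmax; argmax-all; f[xs]≤f[argmax])
open import Data.Product using (Σ; _×_; _,_; proj₁; proj₂)
open import Data.Sum using (_⊎_; inj₁; inj₂)
open import Data.Empty using (⊥-elim)
open import Function.Bundles using (_⇔_; mk⇔)
open import Relation.Nullary using (¬_; Dec; yes; no)
open import Relation.Binary.PropositionalEquality using (_≡_; _≢_; refl; sym; trans; cong; cong₂; subst; module ≡-Reasoning)

𝟙 : ∀ n → Monomial n
𝟙 n = replicate n 0

deg-𝟙 : ∀ n → deg (𝟙 n) ≡ 0
deg-𝟙 zero    = refl
deg-𝟙 (suc n) = deg-𝟙 n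

deg≡0⇒𝟙 : ∀ {n} (m : Monomial n) → deg m ≡ 0 → m ≡ 𝟙 n
deg≡0⇒𝟙 []          _  = refl
deg≡0⇒𝟙 (zero ∷ m)  eq = cong (0 ∷_) (deg≡0⇒𝟙 m eq)
deg≡0⇒𝟙 (suc _ ∷ _) ()

infix 4 _≼_
_≼_ : ∀ {n} → Monomial n → Monomial n → Set
_≼_ = Pointwise _≤_

≼⇒∣ᵐ : ∀ {n} {a b : Monomial n} → a ≼ b → a ∣ᵐ b
≼⇒∣ᵐ = Pointwise.lookup

∣ᵐ⇒≼ : ∀ {n} {a b : Monomial n} → a ∣ᵐ b → a ≼ b
∣ᵐ⇒≼ {a = []}    {[]}    _   = []
∣ᵐ⇒≼ {a = _ ∷ _} {_ ∷ _} a∣b = a∣b fz ∷ ∣ᵐ⇒≼ (λ k → a∣b (fs k))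

≼-refl : ∀ {n} {a : Monomial n} → a ≼ a
≼-refl = Pointwise.refl ≤-refl

≼-trans : ∀ {n} {a b c : Monomial n} → a ≼ b → b ≼ c → a ≼ c
≼-trans = Pointwise.trans ≤-trans

_≼?_ : ∀ {n} (a b : Monomial n) → Dec (a ≼ b)
_≼?_ = Pointwise.decidable _≤?_

𝟙-≼ : ∀ {n} (m : Monomial n) → 𝟙 n ≼ m
𝟙-≼ []      = []
𝟙-≼ (_ ∷ m) = z≤n ∷ 𝟙-≼ m

≼⇒deg≤ : ∀ {n} {a b : Monomial n} → a ≼ b → deg a ≤ deg b
≼⇒deg≤ []           = z≤n
≼⇒deg≤ (x≤y ∷ a≼b) = +-mono-≤ x≤y (≼⇒deg≤ a≼b)

≼-antisym : ∀ {n} {a b : Monomial n} → a ≼ b → deg b ≤ deg a → a ≡ b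
≼-antisym []                            _        = refl
≼-antisym {a = x ∷ a} {y ∷ b} (x≤y ∷ a≼b) y+b≤x+a = cong₂ _∷_ x≡y (≼-antisym a≼b b≤a)
  where
  y≤x : y ≤ x
  y≤x = +-cancelʳ-≤ (deg b) y x (≤-trans y+b≤x+a (+-monoʳ-≤ x (≼⇒deg≤ a≼b)))
  x≡y : x ≡ y
  x≡y = ≤-antisym x≤y y≤x
  b≤a : deg b ≤ deg a
  b≤a = +-cancelˡ-≤ y (deg b) (deg a) (subst (λ z → y + deg b ≤ z + deg a) x≡y y+b≤x+a)

infixl 7 _·_
_·_ : ∀ {n} → Monomial n → Monomial n → Monomial n
_·_ = zipWith _+_

·-comm : ∀ {n} (a b : Monomial n) → a · b ≡ b · a
·-comm []      []      = refl
·-comm (x ∷ a) (y ∷ b) = cong₂ _∷_ (+-comm x y) (·-comm a b)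

leadVar : ∀ {n} → Monomial n → Monomial n
leadVar []                = []
leadVar (zero ∷ m)        = 0 ∷ leadVar m
leadVar {suc n} (suc _ ∷ _) = 1 ∷ 𝟙 n

cofactor : ∀ {n} → Monomial n → Monomial n
cofactor []          = []
cofactor (zero ∷ m)  = 0 ∷ cofactor m
cofactor (suc a ∷ m) = a ∷ m

leadVar·cofactor : ∀ {n} (m : Monomial n) → leadVar m · cofactor m ≡ m
leadVar·cofactor []          = refl
leadVar·cofactor (zero ∷ m)  = cong (0 ∷_) (leadVar·cofactor m)
leadVar·cofactor (suc a ∷ m) = cong (suc a ∷_) (𝟙·m m)
  where
  𝟙·m : ∀ {n} (m : Monomial n) → 𝟙 n · m ≡ m
  𝟙·m []      = refl
  𝟙·m (x ∷ m) = cong (x ∷_) (𝟙·m m)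

deg-leadVar : ∀ {n k} (m : Monomial n) → deg m ≡ suc k → deg (leadVar m) ≡ 1
deg-leadVar (zero ∷ m)        eq = deg-leadVar m eq
deg-leadVar {suc n} (suc _ ∷ _) _ = cong suc (deg-𝟙 n)

deg-cofactor : ∀ {n k} (m : Monomial n) → deg m ≡ suc k → deg (cofactor m) ≡ k
deg-cofactor (zero ∷ m)  eq = deg-cofactor m eq
deg-cofactor (suc a ∷ m) eq = suc-injective eq

leadVar-≼ : ∀ {n} (m : Monomial n) → leadVar m ≼ m
leadVar-≼ []          = []
leadVar-≼ (zero ∷ m)  = z≤n ∷ leadVar-≼ m
leadVar-≼ (suc _ ∷ m) = s≤s z≤n ∷ 𝟙-≼ m

cofactor-≼ : ∀ {n} (m : Monomial n) → cofactor m ≼ m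
cofactor-≼ []          = []
cofactor-≼ (zero ∷ m)  = z≤n ∷ cofactor-≼ m
cofactor-≼ (suc a ∷ m) = n≤1+n a ∷ ≼-refl

deg-1-divisor : ∀ {n} {x m : Monomial n} → deg x ≡ 1 → x ≼ m → deg m ≡ 2 →
                x ≡ leadVar m ⊎ x ≡ cofactor m
deg-1-divisor {x = zero ∷ x} {zero ∷ m} dx (_ ∷ x≼m) dm with deg-1-divisor dx x≼m dm
... | inj₁ eq = inj₁ (cong (0 ∷_) eq)
... | inj₂ eq = inj₂ (cong (0 ∷_) eq)
deg-1-divisor {x = zero ∷ x} {suc zero ∷ m} dx (_ ∷ x≼m) dm =
  inj₂ (cong (0 ∷_) (≼-antisym x≼m (≤-reflexive (trans (suc-injective dm) (sym dx)))))
deg-1-divisor {x = zero ∷ x} {suc (suc _) ∷ m} dx (_ ∷ x≼m) dm =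
  ⊥-elim (1+n≰n (begin
    1            ≡⟨ sym dx ⟩
    deg x        ≤⟨ ≼⇒deg≤ x≼m ⟩
    deg m        ≤⟨ m≤n+m (deg m) _ ⟩
    _ + deg m    ≡⟨ suc-injective (suc-injective dm) ⟩
    0            ∎))
  where open ≤-Reasoning
deg-1-divisor {x = suc zero ∷ _} {zero ∷ _} _ (() ∷ _) _
deg-1-divisor {suc n} {x = suc zero ∷ x} {suc _ ∷ _} dx _ _ =
  inj₁ (cong (1 ∷_) (deg≡0⇒𝟙 x (suc-injective dx)))
deg-1-divisor {x = suc (suc _) ∷ _} () _ _

variables : ∀ n → List (Monomial n)
variables zero    = []
variables (suc n) = (1 ∷ 𝟙 n) ∷ map (0 ∷_) (variables n)

length-variables : ∀ n → length (variables n) ≡ n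
length-variables zero    = refl
length-variables (suc n) = cong suc (trans (length-map (0 ∷_) (variables n)) (length-variables n))

deg-variables : ∀ n → All (λ x → deg x ≡ 1) (variables n)
deg-variables zero    = []
deg-variables (suc n) = cong suc (deg-𝟙 n) ∷ All.map⁺ (deg-variables n)

deg≡1⇒∈variables : ∀ {n} (x : Monomial n) → deg x ≡ 1 → x ∈ variables n
deg≡1⇒∈variables (zero ∷ x)       eq = there (∈-map⁺ (0 ∷_) (deg≡1⇒∈variables x eq))
deg≡1⇒∈variables (suc zero ∷ x)   eq = here (cong (1 ∷_) (deg≡0⇒𝟙 x (suc-injective eq)))
deg≡1⇒∈variables (suc (suc _) ∷ _) ()

∷-≢ : ∀ {n a b} {u v : Vec ℕ n} → a ≢ b → (a ∷ u) ≢ (b ∷ v)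
∷-≢ a≢b refl = a≢b refl

∷-injective : ∀ {n a} {u v : Vec ℕ n} → (a ∷ u) ≡ (a ∷ v) → u ≡ v
∷-injective refl = refl

heads-differ : ∀ {n a b} {u : Vec ℕ n} → a ≢ b → (ys : List (Vec ℕ n)) → All ((a ∷ u) ≢_) (map (b ∷_) ys)
heads-differ a≢b ys = All.map⁺ (All.tabulate λ _ → ∷-≢ a≢b)

variables-unique : ∀ n → Unique (variables n)
variables-unique zero    = []
variables-unique (suc n) = heads-differ (λ ()) (variables n) ∷ Unique.map⁺ ∷-injective (variables-unique n)

∈-─ : ∀ {A : Set} {x z : A} {ys : List A} (x∈ys : x ∈ ys) → z ∈ ys → z ≢ x → z ∈ (ys ─ x∈ys)
∈-─ (here refl) (here refl) z≢x = ⊥-elim (z≢x refl)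
∈-─ (here refl) (there z∈)  _   = z∈
∈-─ (there _)   (here refl) _   = here refl
∈-─ (there x∈)  (there z∈)  z≢x = there (∈-─ x∈ z∈ z≢x)

unique-⊆⇒length≤ : ∀ {A : Set} {xs ys : List A} → Unique xs → xs ⊆ ys → length xs ≤ length ys
unique-⊆⇒length≤ {xs = []}     _                 _     = z≤n
unique-⊆⇒length≤ {xs = x ∷ xs} {ys} (x∉xs ∷ uxs) xs⊆ys = begin
  suc (length xs)          ≤⟨ s≤s (unique-⊆⇒length≤ uxs xs⊆ys─x) ⟩
  suc (length (ys ─ x∈ys)) ≡⟨ sym (length-removeAt′ ys (index x∈ys)) ⟩
  length ys                ∎
  where
  open ≤-Reasoning
  x∈ys : x ∈ ys
  x∈ys = xs⊆ys (here refl)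
  xs⊆ys─x : xs ⊆ (ys ─ x∈ys)
  xs⊆ys─x z∈xs = ∈-─ x∈ys (xs⊆ys (there z∈xs)) (λ z≡x → All.lookup x∉xs z∈xs (sym z≡x))

∈⇒1≤length : ∀ {A : Set} {x : A} {xs : List A} → x ∈ xs → 1 ≤ length xs
∈⇒1≤length x∈xs = unique-⊆⇒length≤ ([] ∷ []) λ { (here refl) → x∈xs }

ofDeg : ∀ {n} → ℕ → List (Monomial n) → List (Monomial n)
ofDeg d = filter (λ m → deg m ≟ d)

∈-ofDeg : ∀ {n d} {m : Monomial n} {L : List (Monomial n)} → m ∈ L → deg m ≡ d → m ∈ ofDeg d L
∈-ofDeg {d = d} = ∈-filter⁺ (λ m → deg m ≟ d)

ofDeg-∈ : ∀ {n d} {m : Monomial n} (L : List (Monomial n)) → m ∈ ofDeg d L → m ∈ L × deg m ≡ d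
ofDeg-∈ {d = d} L = ∈-filter⁻ (λ m → deg m ≟ d) {xs = L}

countDeg-++ : ∀ {n} d (xs ys : List (Monomial n)) → countDeg d (xs ++ ys) ≡ countDeg d xs + countDeg d ys
countDeg-++ d xs ys = trans (cong length (filter-++ (λ m → deg m ≟ d) xs ys)) (length-++ (ofDeg d xs))

countDeg-same : ∀ {n} d {xs : List (Monomial n)} → All (λ m → deg m ≡ d) xs → countDeg d xs ≡ length xs
countDeg-same d all = cong length (filter-all (λ m → deg m ≟ d) all)

countDeg-other : ∀ {n} d {e} {xs : List (Monomial n)} → d ≢ e → All (λ m → deg m ≡ e) xs → countDeg d xs ≡ 0
countDeg-other d d≢e all = cong length (filter-none (λ m → deg m ≟ d) (All.map (λ eq eq′ → d≢e (trans (sym eq′) eq)) all))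

tri : ℕ → ℕ
tri r = (r + 1) C 2

tri-suc : ∀ r → tri (suc r) ≡ suc r + tri r
tri-suc r = begin
  tri (suc r)                   ≡⟨ sym (nCk+nC[k+1]≡[n+1]C[k+1] (r + 1) 1) ⟩
  (r + 1) C 1 + tri r           ≡⟨ cong (_+ tri r) (trans (nC1≡n (r + 1)) (+-comm r 1)) ⟩
  suc r + tri r                 ∎
  where open ≡-Reasoning

n≤tri : ∀ n → n ≤ tri n
n≤tri zero    = z≤n
n≤tri (suc n) = subst (suc n ≤_) (sym (tri-suc n)) (m≤m+n (suc n) (tri n))

tri-mono : ∀ {m n} → m ≤ n → tri m ≤ tri n
tri-mono {n = zero}  z≤n = ≤-refl
tri-mono {m} {suc n} m≤1+n with m≤n⇒m<n∨m≡n m≤1+n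
... | inj₂ refl      = ≤-refl
... | inj₁ (s≤s m≤n) = ≤-trans (tri-mono m≤n) (subst (tri n ≤_) (sym (tri-suc n)) (m≤n+m (tri n) (suc n)))

products : ∀ {n} → List (Monomial n) → List (Monomial n)
products []       = []
products (x ∷ xs) = map (x ·_) (x ∷ xs) ++ products xs

length-products : ∀ {n} (xs : List (Monomial n)) → length (products xs) ≡ tri (length xs)
length-products []       = refl
length-products (x ∷ xs) = begin
  length (map (x ·_) (x ∷ xs) ++ products xs)            ≡⟨ length-++ (map (x ·_) (x ∷ xs)) ⟩
  length (map (x ·_) (x ∷ xs)) + length (products xs)    ≡⟨ cong₂ _+_ (length-map (x ·_) (x ∷ xs)) (length-products xs) ⟩
  suc (length xs) + tri (length xs)                      ≡⟨ sym (tri-suc (length xs)) ⟩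
  tri (length (x ∷ xs))                                  ∎
  where open ≡-Reasoning

∈-products : ∀ {n} {a b : Monomial n} {xs : List (Monomial n)} → a ∈ xs → b ∈ xs → a · b ∈ products xs
∈-products (here refl)         b∈xs        = ∈-++⁺ˡ (∈-map⁺ _ b∈xs)
∈-products {a = a} (there a∈xs) (here refl) = subst (_∈ _) (·-comm _ a) (∈-++⁺ˡ (∈-map⁺ _ (there a∈xs)))
∈-products (there a∈xs)        (there b∈xs) = ∈-++⁺ʳ _ (∈-products a∈xs b∈xs)

factors : ∀ {n} → List (Monomial n) → List (Monomial n)
factors []       = []
factors (m ∷ ms) = leadVar m ∷ cofactor m ∷ factors ms

length-factors : ∀ {n} (ms : List (Monomial n)) → length (factors ms) ≡ length ms + length ms
length-factors []       = refl
length-factors (m ∷ ms) = cong suc (trans (cong suc (length-factors ms)) (sym (+-suc (length ms) (length ms))))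

∈-factors : ∀ {n} {m x : Monomial n} {ms : List (Monomial n)} → m ∈ ms →
            x ≡ leadVar m ⊎ x ≡ cofactor m → x ∈ factors ms
∈-factors (here refl)  (inj₁ refl) = here refl
∈-factors (here refl)  (inj₂ refl) = there (here refl)
∈-factors (there m∈ms) x-factor    = there (there (∈-factors m∈ms x-factor))

-- In a finite set of monomials every member divides a maximal member:
-- take a member of largest degree among its multiples.
maximal-above : ∀ {n} (L : List (Monomial n)) {x : Monomial n} → x ∈ L →
                Σ (Monomial n) λ m → IsMaximal L m × x ≼ m
maximal-above L {x} x∈L = m , (m∈L , maximality) , x≼m
  where
  multiples : List (Monomial _)
  multiples = filter (x ≼?_) L
  m : Monomial _
  m = argmax deg x multiples
  m∈L×x≼m : m ∈ L × x ≼ m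
  m∈L×x≼m = argmax-all deg (x∈L , ≼-refl) (All.tabulate (∈-filter⁻ (x ≼?_)))
  m∈L : m ∈ L
  m∈L = proj₁ m∈L×x≼m
  x≼m : x ≼ m
  x≼m = proj₂ m∈L×x≼m
  -- a multiple m′ of m is a multiple of x, so deg m′ ≤ deg m, forcing m′ = m
  maximality : ∀ {m′} → m′ ∈ L → m ∣ᵐ m′ → m′ ≡ m
  maximality m′∈L m∣m′ = sym (≼-antisym (∣ᵐ⇒≼ m∣m′) (All.lookup (f[xs]≤f[argmax] x multiples)
                               (∈-filter⁺ (x ≼?_) m′∈L (≼-trans x≼m (∣ᵐ⇒≼ m∣m′)))))

𝟙∈ideal : ∀ {n} {L : List (Monomial n)} → IsOrderIdeal L → 𝟙 n ∈ L
𝟙∈ideal {L = []}    ideal = ⊥-elim (IsOrderIdeal.nonempty ideal refl)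
𝟙∈ideal {L = m ∷ _} ideal = IsOrderIdeal.closed ideal (here refl) (≼⇒∣ᵐ (𝟙-≼ m))

module PureOfSocleDegree2 {n} {L : List (Monomial n)} (ideal : IsOrderIdeal L) (pure : IsPure 2 L) where
  open IsOrderIdeal ideal

  ofDeg-unique : ∀ d → Unique (ofDeg d L)
  ofDeg-unique d = Unique.filter⁺ (λ m → deg m ≟ d) unique

  below-deg-2 : ∀ {x} → x ∈ L → Σ (Monomial n) λ m → m ∈ ofDeg 2 L × x ≼ m
  below-deg-2 x∈L with maximal-above L x∈L
  ... | m , m-max , x≼m = m , ∈-ofDeg (proj₁ m-max) (pure m-max) , x≼m

  -- 1 ∈ L is the only member of degree 0.
  h₀≡1 : countDeg 0 L ≡ 1
  h₀≡1 = ≤-antisym (unique-⊆⇒length≤ {ys = 𝟙 n ∷ []} (ofDeg-unique 0)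
                                      λ m∈ → here (deg≡0⇒𝟙 _ (proj₂ (ofDeg-∈ L m∈))))
                   (∈⇒1≤length (∈-ofDeg (𝟙∈ideal ideal) (deg-𝟙 n)))

  -- 1 divides a member of degree 2.
  1≤h₂ : 1 ≤ countDeg 2 L
  1≤h₂ = ∈⇒1≤length (proj₁ (proj₂ (below-deg-2 (𝟙∈ideal ideal))))

  -- Each variable of L is one of the two factors of a degree-2 member.
  h₁≤2h₂ : countDeg 1 L ≤ countDeg 2 L + countDeg 2 L
  h₁≤2h₂ = subst (countDeg 1 L ≤_) (length-factors (ofDeg 2 L))
                 (unique-⊆⇒length≤ (ofDeg-unique 1) ofDeg1⊆factors)
    where
    ofDeg1⊆factors : ofDeg 1 L ⊆ factors (ofDeg 2 L)
    ofDeg1⊆factors x∈ with ofDeg-∈ L x∈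
    ... | x∈L , deg-x with below-deg-2 x∈L
    ...   | m , m∈ , x≼m = ∈-factors m∈ (deg-1-divisor deg-x x≼m (proj₂ (ofDeg-∈ L m∈)))

  -- Each degree-2 member is the product of its two factors, which lie in L.
  h₂≤tri-h₁ : countDeg 2 L ≤ tri (countDeg 1 L)
  h₂≤tri-h₁ = subst (countDeg 2 L ≤_) (length-products (ofDeg 1 L))
                    (unique-⊆⇒length≤ (ofDeg-unique 2) ofDeg2⊆products)
    where
    factor∈ : ∀ {m x} → m ∈ L → x ≼ m → deg x ≡ 1 → x ∈ ofDeg 1 L
    factor∈ m∈L x≼m = ∈-ofDeg (closed m∈L (≼⇒∣ᵐ x≼m))
    ofDeg2⊆products : ofDeg 2 L ⊆ products (ofDeg 1 L)
    ofDeg2⊆products {m} m∈ with ofDeg-∈ L m∈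
    ... | m∈L , deg-m = subst (_∈ products (ofDeg 1 L)) (leadVar·cofactor m)
                              (∈-products (factor∈ m∈L (leadVar-≼ m) (deg-leadVar m deg-m))
                                          (factor∈ m∈L (cofactor-≼ m) (deg-cofactor m deg-m)))

Admissible : ℕ → ℕ → Set
Admissible r h = 1 ≤ r × ⌈ r /2⌉ ≤ h × h ≤ tri r

⌈/2⌉≤ : ∀ {b c} → b ≤ c + c → ⌈ b /2⌉ ≤ c
⌈/2⌉≤ {c = c} b≤2c = subst (_ ≤_) (sym (n≡⌈n+n/2⌉ c)) (⌈n/2⌉-mono b≤2c)

1≤tri⇒1≤ : ∀ {r} → 1 ≤ tri r → 1 ≤ r
1≤tri⇒1≤ {suc _} _ = s≤s z≤n

necessary : ∀ {a b c} → IsPureOSeq 2 (a ∷ b ∷ c ∷ []) → a ≡ 1 × Admissible b c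
necessary (n , L , ideal , pure , h-vector)
  with h-vector fz | h-vector (fs fz) | h-vector (fs (fs fz))
... | refl | refl | refl =
  h₀≡1 , 1≤tri⇒1≤ (≤-trans 1≤h₂ h₂≤tri-h₁) , ⌈/2⌉≤ h₁≤2h₂ , h₂≤tri-h₁
  where open PureOfSocleDegree2 ideal pure

pure-if-dominated : ∀ {n e} {L : List (Monomial n)} →
  (∀ {x} → x ∈ L → Σ (Monomial n) λ m → m ∈ L × deg m ≡ e × x ≼ m) → IsPure e L
pure-if-dominated {e = e} below (m∈L , maximal) with below m∈L
... | p , p∈L , deg-p , m≼p = subst (λ q → deg q ≡ e) (maximal p∈L (≼⇒∣ᵐ m≼p)) deg-p

record Cover (r h : ℕ) : Set where
  field
    quadrics : List (Monomial r)
    deg-2    : All (λ m → deg m ≡ 2) quadrics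
    distinct : Unique quadrics
    covering : All (λ x → Any (x ≼_) quadrics) (variables r)
    size     : length quadrics ≡ h

module IdealOfCover {r h} (C : Cover (suc r) h) where
  n : ℕ
  n = suc r

  open Cover C
  open ≡-Reasoning

  L : List (Monomial n)
  L = 𝟙 n ∷ variables n ++ quadrics

  deg≤2 : ∀ {m} → m ∈ L → deg m ≤ 2
  deg≤2 (here refl) = ≤-trans (≤-reflexive (deg-𝟙 n)) z≤n
  deg≤2 (there m∈) with ∈-++⁻ (variables n) m∈
  ... | inj₁ x∈ = ≤-trans (≤-reflexive (All.lookup (deg-variables n) x∈)) (n≤1+n 1)
  ... | inj₂ q∈ = ≤-reflexive (All.lookup deg-2 q∈)

  𝟙≢ : ∀ {k m} → deg m ≡ suc k → 𝟙 n ≢ m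
  𝟙≢ deg-m 𝟙≡m = 0≢1+n (trans (sym (deg-𝟙 n)) (trans (cong deg 𝟙≡m) deg-m))

  distinct-L : Unique L
  distinct-L = All.++⁺ (All.map 𝟙≢ (deg-variables n)) (All.map 𝟙≢ deg-2)
             ∷ Unique.++⁺ (variables-unique n) distinct
                 (λ (x∈ , q∈) → 1+n≢n (trans (sym (All.lookup deg-2 q∈)) (All.lookup (deg-variables n) x∈)))

  -- A divisor of a member is 1, a variable, or (having degree ≥ 2) the member itself.
  closed : ∀ {m m′} → m ∈ L → m′ ∣ᵐ m → m′ ∈ L
  closed {m} {m′} m∈L m′∣m with deg m′ in deg-m′
  ... | 0           = here (deg≡0⇒𝟙 m′ deg-m′)
  ... | 1           = there (∈-++⁺ˡ (deg≡1⇒∈variables m′ deg-m′))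
  ... | suc (suc _) = subst (_∈ L) (sym (≼-antisym (∣ᵐ⇒≼ m′∣m) deg-m≤deg-m′)) m∈L
    where
    deg-m≤deg-m′ : deg m ≤ deg m′
    deg-m≤deg-m′ = ≤-trans (deg≤2 m∈L) (subst (2 ≤_) (sym deg-m′) (s≤s (s≤s z≤n)))

  ideal : IsOrderIdeal L
  ideal = record { unique = distinct-L ; nonempty = λ () ; closed = closed }

  quadric-above : ∀ {x} → x ∈ variables n → Σ (Monomial n) λ m → m ∈ L × deg m ≡ 2 × x ≼ m
  quadric-above x∈ with find (All.lookup covering x∈)
  ... | q , q∈ , x≼q = q , there (∈-++⁺ʳ (variables n) q∈) , All.lookup deg-2 q∈ , x≼q

  -- Every member divides a quadric (1 divides the one covering the first variable).
  dominated : ∀ {x} → x ∈ L → Σ (Monomial n) λ m → m ∈ L × deg m ≡ 2 × x ≼ m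
  dominated (here refl) with quadric-above (here refl)
  ... | q , q∈ , deg-q , _ = q , q∈ , deg-q , 𝟙-≼ q
  dominated (there m∈) with ∈-++⁻ (variables n) m∈
  ... | inj₁ x∈ = quadric-above x∈
  ... | inj₂ q∈ = _ , there (∈-++⁺ʳ (variables n) q∈) , All.lookup deg-2 q∈ , ≼-refl

  deg-one : All (λ m → deg m ≡ 0) (𝟙 n ∷ [])
  deg-one = deg-𝟙 n ∷ []

  count : ∀ d → countDeg d L ≡ countDeg d (𝟙 n ∷ []) + (countDeg d (variables n) + countDeg d quadrics)
  count d = trans (countDeg-++ d (𝟙 n ∷ []) _) (cong (_ +_) (countDeg-++ d (variables n) quadrics))

  h₀ : countDeg 0 L ≡ 1
  h₀ = begin
    countDeg 0 L
      ≡⟨ count 0 ⟩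
    countDeg 0 (𝟙 n ∷ []) + (countDeg 0 (variables n) + countDeg 0 quadrics)
      ≡⟨ cong₂ _+_ (countDeg-same 0 deg-one)
                   (cong₂ _+_ (countDeg-other 0 (λ ()) (deg-variables n)) (countDeg-other 0 (λ ()) deg-2)) ⟩
    1
      ∎

  h₁ : countDeg 1 L ≡ n
  h₁ = begin
    countDeg 1 L
      ≡⟨ count 1 ⟩
    countDeg 1 (𝟙 n ∷ []) + (countDeg 1 (variables n) + countDeg 1 quadrics)
      ≡⟨ cong₂ _+_ (countDeg-other 1 (λ ()) deg-one)
                   (cong₂ _+_ (countDeg-same 1 (deg-variables n)) (countDeg-other 1 (λ ()) deg-2)) ⟩
    length (variables n) + 0
      ≡⟨ +-identityʳ _ ⟩
    length (variables n)
      ≡⟨ length-variables n ⟩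
    n
      ∎

  h₂ : countDeg 2 L ≡ h
  h₂ = begin
    countDeg 2 L
      ≡⟨ count 2 ⟩
    countDeg 2 (𝟙 n ∷ []) + (countDeg 2 (variables n) + countDeg 2 quadrics)
      ≡⟨ cong₂ _+_ (countDeg-other 2 (λ ()) deg-one)
                   (cong₂ _+_ (countDeg-other 2 (λ ()) (deg-variables n)) (countDeg-same 2 deg-2)) ⟩
    length quadrics
      ≡⟨ size ⟩
    h
      ∎

  isPureOSeq : IsPureOSeq 2 (1 ∷ n ∷ h ∷ [])
  isPureOSeq = n , L , ideal , pure-if-dominated dominated , λ where
    fz           → sym h₀
    (fs fz)      → sym h₁
    (fs (fs fz)) → sym h₂

emptyCover : Cover 0 0
emptyCover = record { quadrics = [] ; deg-2 = [] ; distinct = [] ; covering = [] ; size = refl }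

pad-covering : ∀ {r} {V P : List (Monomial r)} (X : List (Monomial (suc r))) →
  All (λ x → Any (x ≼_) P) V → All (λ x → Any (x ≼_) (X ++ map (0 ∷_) P)) (map (0 ∷_) V)
pad-covering X covered = All.map⁺ (All.map (λ x≼P → Any.++⁺ʳ X (Any.map⁺ (Any.map (z≤n ∷_) x≼P))) covered)

-- A new variable x₀, covered by x₀², together with x₀·xᵢ for k of the old
-- variables: a cover of size h in r variables gives one of size 1 + k + h.
addVariable : ∀ {r h} k → k ≤ r → Cover r h → Cover (suc r) (suc (k + h))
addVariable {r} {h} k k≤r C = record
  { quadrics = (2 ∷ 𝟙 r) ∷ mixed ++ old
  ; deg-2    = cong (2 +_) (deg-𝟙 r)
             ∷ All.++⁺ (All.map⁺ (All.map (cong suc) (All.take⁺ k (deg-variables r)))) (All.map⁺ deg-2)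
  ; distinct = All.++⁺ (heads-differ (λ ()) (take k (variables r))) (heads-differ (λ ()) quadrics)
             ∷ Unique.++⁺ (Unique.map⁺ ∷-injective (Unique.take⁺ k (variables-unique r)))
                          (Unique.map⁺ ∷-injective distinct) mixed∩old≡∅
  ; covering = here (s≤s z≤n ∷ ≼-refl) ∷ pad-covering (_ ∷ mixed) covering
  ; size     = cong suc (begin
      length (mixed ++ old)         ≡⟨ length-++ mixed ⟩
      length mixed + length old     ≡⟨ cong₂ _+_ length-mixed (trans (length-map (0 ∷_) quadrics) size) ⟩
      k + h                         ∎)
  }
  where
  open Cover C
  open ≡-Reasoning
  mixed old : List (Monomial (suc r))
  mixed = map (1 ∷_) (take k (variables r))
  old   = map (0 ∷_) quadrics
  mixed∩old≡∅ : ∀ {m} → ¬ (m ∈ mixed × m ∈ old)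
  mixed∩old≡∅ (m∈mixed , m∈old) with ∈-map⁻ (1 ∷_) m∈mixed | ∈-map⁻ (0 ∷_) m∈old
  ... | _ , _ , refl | _ , _ , eq = ∷-≢ (λ ()) eq
  length-mixed : length mixed ≡ k
  length-mixed = begin
    length mixed                         ≡⟨ length-map (1 ∷_) (take k (variables r)) ⟩
    length (take k (variables r))        ≡⟨ length-take k (variables r) ⟩
    k ⊓ length (variables r)             ≡⟨ cong (k ⊓_) (length-variables r) ⟩
    k ⊓ r                                ≡⟨ m≤n⇒m⊓n≡m k≤r ⟩
    k                                    ∎

-- Two new variables x₀, x₁, covered by the single new quadric x₀·x₁.
addVariablePair : ∀ {r h} → Cover r h → Cover (suc (suc r)) (suc h)
addVariablePair {r} C = record
  { quadrics = (1 ∷ 1 ∷ 𝟙 r) ∷ old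
  ; deg-2    = cong (2 +_) (deg-𝟙 r) ∷ All.map⁺ (All.map⁺ deg-2)
  ; distinct = heads-differ (λ ()) (map (0 ∷_) quadrics)
             ∷ Unique.map⁺ ∷-injective (Unique.map⁺ ∷-injective distinct)
  ; covering = here (s≤s z≤n ∷ z≤n ∷ ≼-refl) ∷ here (z≤n ∷ s≤s z≤n ∷ ≼-refl)
             ∷ pad-covering (_ ∷ []) (pad-covering [] covering)
  ; size     = cong suc (trans (length-map (0 ∷_) (map (0 ∷_) quadrics)) (trans (length-map (0 ∷_) quadrics) size))
  }
  where
  open Cover C
  old : List (Monomial (suc (suc r)))
  old = map (0 ∷_) (map (0 ∷_) quadrics)

above-tri : ∀ {r h} → tri r < h → h ≤ tri (suc r) → Σ ℕ λ k → k ≤ r × suc (k + tri r) ≡ h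
above-tri {r} {h} tri<h h≤tri′ = h ∸ suc (tri r) , k≤r , k+1+tri≡h
  where
  k≤r : h ∸ suc (tri r) ≤ r
  k≤r = ≤-trans (∸-monoˡ-≤ (suc (tri r)) (subst (h ≤_) (tri-suc r) h≤tri′)) (≤-reflexive (m+n∸n≡m r (tri r)))
  k+1+tri≡h : suc (h ∸ suc (tri r) + tri r) ≡ h
  k+1+tri≡h = trans (cong suc (+-comm (h ∸ suc (tri r)) (tri r))) (m+[n∸m]≡n tri<h)

-- Covers exist for every size h with ⌈ r/2 ⌉ ≤ h ≤ tri r, by induction on r:
-- sizes above tri (r - 1) by addVariable from the full cover, smaller sizes
-- by addVariable with k = 0, and the one remaining size ⌈ r/2 ⌉ (r even) by
-- addVariablePair.
cover-exists : ∀ r h → ⌈ r /2⌉ ≤ h → h ≤ tri r → Cover r h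
cover-exists zero h _ h≤0 = subst (Cover 0) (sym (n≤0⇒n≡0 h≤0)) emptyCover
cover-exists (suc r) h lo hi with h ≤? tri r
... | no h≰tri with above-tri (≰⇒> h≰tri) hi
...   | k , k≤r , k+1+tri≡h = subst (Cover (suc r)) k+1+tri≡h
          (addVariable k k≤r (cover-exists r (tri r) (≤-trans (⌈n/2⌉≤n r) (n≤tri r)) ≤-refl))
cover-exists (suc r) (suc h) lo hi | yes h+1≤tri with ⌈ r /2⌉ ≤? h
... | yes lo′ = addVariable 0 z≤n (cover-exists r h lo′ (≤-trans (n≤1+n h) h+1≤tri))
cover-exists (suc zero)    (suc h) _        _ | yes _ | no lo′ = ⊥-elim (lo′ z≤n)
cover-exists (suc (suc r)) (suc h) (s≤s lo) _ | yes _ | no h<⌈r+1/2⌉ =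
  addVariablePair (cover-exists r h lo (≤-trans (≤-pred (≰⇒> h<⌈r+1/2⌉)) (≤-trans (⌊n/2⌋≤n r) (n≤tri r))))

sufficient : ∀ {r h} → Admissible r h → IsPureOSeq 2 (1 ∷ r ∷ h ∷ [])
sufficient {suc r} {h} (_ , lo , hi) = IdealOfCover.isPureOSeq (cover-exists (suc r) h lo hi)

up∩down-convex : ∀ {P Q : ℕ → Set} →
  (∀ {x y} → x ≤ y → P x → P y) → (∀ {x y} → x ≤ y → Q y → Q x) →
  ∀ {a b v} → P a × Q a → P b × Q b → Between a b v → P v × Q v
up∩down-convex up down (pa , _) (_ , qb) (inj₁ (a≤v , v≤b)) = up a≤v pa , down v≤b qb
up∩down-convex up down (_ , qa) (pb , _) (inj₂ (b≤v , v≤a)) = up b≤v pb , down v≤a qa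

admissible-convex-r : ∀ {r₁ r₂ h v} → Admissible r₁ h → Admissible r₂ h → Between r₁ r₂ v → Admissible v h
admissible-convex-r {h = h} (1≤r₁ , lo₁ , hi₁) (1≤r₂ , lo₂ , hi₂) btw
  with up∩down-convex {P = λ r → 1 ≤ r × h ≤ tri r} {Q = λ r → ⌈ r /2⌉ ≤ h}
         (λ x≤y (1≤x , hi) → ≤-trans 1≤x x≤y , ≤-trans hi (tri-mono x≤y))
         (λ x≤y lo → ≤-trans (⌈n/2⌉-mono x≤y) lo)
         ((1≤r₁ , hi₁) , lo₁) ((1≤r₂ , hi₂) , lo₂) btw
... | (1≤v , hi) , lo = 1≤v , lo , hi

admissible-convex-h : ∀ {r h₁ h₂ v} → Admissible r h₁ → Admissible r h₂ → Between h₁ h₂ v → Admissible r v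
admissible-convex-h {r} (1≤r , lo₁ , hi₁) (_ , lo₂ , hi₂) btw
  with up∩down-convex {P = ⌈ r /2⌉ ≤_} {Q = _≤ tri r}
         (λ x≤y lo → ≤-trans lo x≤y) (λ x≤y hi → ≤-trans x≤y hi) (lo₁ , hi₁) (lo₂ , hi₂) btw
... | lo , hi = 1≤r , lo , hi

between-same : ∀ {a v} → Between a a v → v ≡ a
between-same (inj₁ (a≤v , v≤a)) = ≤-antisym v≤a a≤v
between-same (inj₂ (a≤v , v≤a)) = ≤-antisym v≤a a≤v

corollary4p7 :
    ((r h₂ : ℕ) → 1 ≤ r →
      (IsPureOSeq 2 (1 ∷ r ∷ h₂ ∷ []) ⇔ (⌈ r /2⌉ ≤ h₂ × h₂ ≤ (r + 1) C 2)))
    ×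
    ((h h' : Vec ℕ 3) (j : Fin 3) (v : ℕ) →
      IsPureOSeq 2 h → IsPureOSeq 2 h' →
      ((i : Fin 3) → i ≢ j → lookup h i ≡ lookup h' i) →
      Between (lookup h j) (lookup h' j) v →
      IsPureOSeq 2 (h [ j ]≔ v))
corollary4p7 = characterisation , interval-property
  where
  characterisation : (r h₂ : ℕ) → 1 ≤ r →
    IsPureOSeq 2 (1 ∷ r ∷ h₂ ∷ []) ⇔ (⌈ r /2⌉ ≤ h₂ × h₂ ≤ (r + 1) C 2)
  characterisation r h₂ 1≤r = mk⇔ (λ pure → proj₂ (proj₂ (necessary pure))) (λ bounds → sufficient (1≤r , bounds))

  -- h₀ is always 1, and changing h₁ or h₂ alone stays admissible by convexity.
  interval-property : (h h' : Vec ℕ 3) (j : Fin 3) (v : ℕ) →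
    IsPureOSeq 2 h → IsPureOSeq 2 h' →
    ((i : Fin 3) → i ≢ j → lookup h i ≡ lookup h' i) →
    Between (lookup h j) (lookup h' j) v →
    IsPureOSeq 2 (h [ j ]≔ v)
  interval-property (a ∷ b ∷ c ∷ []) (_ ∷ _ ∷ _ ∷ []) fz v pure pure′ _ btw
    with necessary pure | necessary pure′
  ... | refl , _ | refl , _ = subst (λ x → IsPureOSeq 2 (x ∷ b ∷ c ∷ [])) (sym (between-same btw)) pure
  interval-property (a ∷ b ∷ c ∷ []) (_ ∷ _ ∷ _ ∷ []) (fs fz) v pure pure′ agree btw
    with necessary pure | necessary pure′ | agree (fs (fs fz)) (λ ())
  ... | refl , adm | _ , adm′ | refl = sufficient (admissible-convex-r adm adm′ btw)
  interval-property (a ∷ b ∷ c ∷ []) (_ ∷ _ ∷ _ ∷ []) (fs (fs fz)) v pure pure′ agree btw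
    with necessary pure | necessary pure′ | agree (fs fz) (λ ())
  ... | refl , adm | _ , adm′ | refl = sufficient (admissible-convex-h adm adm′ btw)
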